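{- Let $q$ be a power of a prime $p$, $R$ an algebraically closed field of characteristic $\ell>0$, $\ell\neq p$, $k\geq 1$, $\mathcal{M}=\operatorname{GL}_k(\mathbb{F}_q)\times\operatorname{GL}_k(\mathbb{F}_q)\subset\operatorname{GL}_{2k}(\mathbb{F}_q)$ (block diagonal), and $$T^{\ast}=\sum_{g\in\operatorname{GL}_k(\mathbb{F}_q)}\begin{pmatrix}g&\\&-g^{ -1}\end{pmatrix}\in R[\mathcal{M}].$$ Let $(\sigma,V)$ be a finite-dimensional representation of $\mathcal{M}$ over $R$, and let $I_1=\operatorname{End}_{\mathcal{M}}(V)$, $I_w=\operatorname{Hom}_{\mathcal{M}}(V^w,V)$. Then: (i) if $\ell$ divides $q-1$, then $(T^{\ast})^2=0$ in $R[\mathcal{M}]$; (ii) if $f\in I_1$ (resp. $f\in I_w$), then $\sigma(T^\ast)\circ f=f\circ\sigma(T^\ast)$, and this element lies in $I_w$ (resp. $I_1$).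
   Context: $w=\left(\begin{smallmatrix}0&\mathbf{1}_k\\\mathbf{1}_k&0\end{smallmatrix}\right)$, and $V^w$ denotes $V$ with $m\in\mathcal{M}$ acting by $\sigma(wmw^{ -1})$. -}

module Defs where

open import Level using (0ℓ)
open import Data.Nat as ℕ using (ℕ; zero; suc)
open import Data.Fin using (Fin)
open import Data.Product using (Σ; ∃; _×_; _,_; proj₁; proj₂)
open import Data.List as List using (List; []; _∷_; _++_; foldr; map; filter; cartesianProduct; concatMap; length)
open import Data.List.Membership.Propositional using (_∈_)
open import Data.List.Relation.Unary.Unique.Propositional using (Unique)
open import Data.Vec as Vec using (Vec; lookup; tabulate; allFin)
open import Data.Vec.Properties using (≡-dec)
open import Relation.Binary.PropositionalEquality using (_≡_; _≢_)
open import Relation.Binary.Definitions using (DecidableEquality)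
open import Relation.Nullary using (¬_; yes; no)
open import Relation.Nullary.Decidable using (_×-dec_)
open import Algebra.Core using (Op₁; Op₂)
open import Algebra.Structures using (IsCommutativeRing)

record Field : Set₁ where
  infixl 7 _*_
  infixl 6 _+_
  field
    Carrier           : Set
    _+_ _*_           : Op₂ Carrier
    -_                : Op₁ Carrier
    0# 1#             : Carrier
    isCommutativeRing : IsCommutativeRing _≡_ _+_ _*_ -_ 0# 1#
    0≢1               : 0# ≢ 1#
    inverse           : ∀ x → x ≢ 0# → ∃ λ y → x * y ≡ 1#

module FieldOps (F : Field) where
  open Field F

  fromℕ : ℕ → Carrier
  fromℕ zero    = 0#
  fromℕ (suc n) = 1# + fromℕ n

  HasChar : ℕ → Set
  HasChar ℓ = (0 ℕ.< ℓ) × (fromℕ ℓ ≡ 0#) × (∀ m → 0 ℕ.< m → m ℕ.< ℓ → fromℕ m ≢ 0#)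

  -- polynomial evaluation, coefficients listed from degree 0 upwards
  evalPoly : List Carrier → Carrier → Carrier
  evalPoly []       x = 0#
  evalPoly (c ∷ cs) x = c + x * evalPoly cs x

  -- every polynomial of degree ≥ 1 (leading coefficient a ≠ 0) has a root
  IsAlgClosed : Set
  IsAlgClosed = ∀ (c : Carrier) (cs : List Carrier) (a : Carrier) → a ≢ 0# →
                ∃ λ x → evalPoly (c ∷ cs ++ a ∷ []) x ≡ 0#

  sumL : List Carrier → Carrier
  sumL = foldr _+_ 0#

  Mat : ℕ → Set
  Mat n = Vec (Vec Carrier n) n

  entry : ∀ {n} → Mat n → Fin n → Fin n → Carrier
  entry A i j = lookup (lookup A i) j

  mkMat : ∀ {n} → (Fin n → Fin n → Carrier) → Mat n
  mkMat f = tabulate λ i → tabulate λ j → f i j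

  infixl 7 _⊗_
  infixl 6 _⊕_
  _⊗_ : ∀ {n} → Mat n → Mat n → Mat n
  _⊗_ {n} A B = mkMat λ i j → sumL (Vec.toList (Vec.map (λ l → entry A i l * entry B l j) (allFin n)))

  _⊕_ : ∀ {n} → Mat n → Mat n → Mat n
  A ⊕ B = mkMat λ i j → entry A i j + entry B i j

  _·_ : ∀ {n} → Carrier → Mat n → Mat n
  c · A = mkMat λ i j → c * entry A i j

  ⊖_ : ∀ {n} → Mat n → Mat n
  ⊖ A = mkMat λ i j → - entry A i j

  𝟎 : ∀ {n} → Mat n
  𝟎 = mkMat λ _ _ → 0#

  𝟙 : ∀ {n} → Mat n
  𝟙 = mkMat λ i j → δ i j
    where
    δ : ∀ {n} → Fin n → Fin n → Carrier
    δ i j with Data.Fin._≟_ i j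
    ... | yes _ = 1#
    ... | no  _ = 0#

  sumM : ∀ {n} → List (Mat n) → Mat n
  sumM = foldr _⊕_ 𝟎

  IsGL : ∀ {n} → Mat n → Set
  IsGL A = ∃ λ B → (A ⊗ B ≡ 𝟙) × (B ⊗ A ≡ 𝟙)

record FiniteField : Set₁ where
  field
    fld      : Field
  open Field fld public
  field
    _≟_      : DecidableEquality Carrier
    elems    : List Carrier
    complete : ∀ x → x ∈ elems
    unique   : Unique elems

  card : ℕ
  card = length elems

allVecs : ∀ {A : Set} → List A → (n : ℕ) → List (Vec A n)
allVecs xs zero    = Vec.[] ∷ []
allVecs xs (suc n) = concatMap (λ x → map (x Vec.∷_) (allVecs xs n)) xs

module FFMat (Fq : FiniteField) where
  open FiniteField Fq
  open FieldOps fld public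

  _≟M_ : ∀ {n} → DecidableEquality (Mat n)
  _≟M_ = ≡-dec (≡-dec _≟_)

  allMats : (k : ℕ) → List (Mat k)
  allMats k = allVecs (allVecs elems k) k

  -- GL_k(Fq), listed as pairs (g , g⁻¹), each g exactly once
  glList : (k : ℕ) → List (Mat k × Mat k)
  glList k = filter (λ p → ((proj₁ p ⊗ proj₂ p) ≟M 𝟙) ×-dec ((proj₂ p ⊗ proj₁ p) ≟M 𝟙))
                    (cartesianProduct (allMats k) (allMats k))

module Setting (Fq : FiniteField) (R : Field) (k n : ℕ) where
  open FFMat Fq renaming (Mat to MatF; _⊗_ to _⊗F_; 𝟙 to 𝟙F; ⊖_ to ⊖F_; IsGL to IsGLF) hiding (_·_; _⊕_; 𝟎; sumM; sumL; entry; mkMat; fromℕ; HasChar; evalPoly; IsAlgClosed)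
  open Field R using () renaming (Carrier to RC; 0# to 0R; 1# to 1R; _*_ to _*R_)
  module RO = FieldOps R
  open RO using (sumL) renaming (Mat to MatR; _⊗_ to _⊗R_; 𝟙 to 𝟙R; _·_ to _·R_; sumM to sumMR)

  -- elements of 𝓜 = GL_k(Fq) × GL_k(Fq) (block diagonal diag(a , b)),
  -- represented by pairs of matrices
  MEl : Set
  MEl = MatF k × MatF k

  InM : MEl → Set
  InM (a , b) = IsGLF a × IsGLF b

  -- multiplication in 𝓜 (block diagonal matrices multiply blockwise)
  _∙M_ : MEl → MEl → MEl
  (a , b) ∙M (a' , b') = (a ⊗F a') , (b ⊗F b')

  _≟E_ : (x y : MEl) → Relation.Nullary.Dec (x ≡ y)
  (a , b) ≟E (a' , b') with a ≟M a' | b ≟M b'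
  ... | yes Relation.Binary.PropositionalEquality.refl | yes Relation.Binary.PropositionalEquality.refl = yes Relation.Binary.PropositionalEquality.refl
  ... | no ¬p | _ = no λ { Relation.Binary.PropositionalEquality.refl → ¬p Relation.Binary.PropositionalEquality.refl }
  ... | yes _ | no ¬q = no λ { Relation.Binary.PropositionalEquality.refl → ¬q Relation.Binary.PropositionalEquality.refl }

  mList : List MEl
  mList = cartesianProduct (map proj₁ (glList k)) (map proj₁ (glList k))

  -- conjugation by w = [[0,1_k],[1_k,0]]: w·diag(a,b)·w⁻¹ = diag(b,a)
  conjW : MEl → MEl
  conjW (a , b) = (b , a)

  -- group algebra R[𝓜]: R-valued functions on 𝓜 (𝓜 is finite)
  RM : Set
  RM = MEl → RC

  _≈RM_ : RM → RM → Set
  x ≈RM y = ∀ m → InM m → x m ≡ y m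

  δ : MEl → RM
  δ g m with g ≟E m
  ... | yes _ = 1R
  ... | no  _ = 0R

  zeroRM : RM
  zeroRM _ = 0R

  sumRM : List RM → RM
  sumRM xs m = sumL (map (λ x → x m) xs)

  _⋆_ : RM → RM → RM
  (x ⋆ y) m = sumL (map (λ u → sumL (map (λ v → δ (u ∙M v) m *R (x u *R y v)) mList)) mList)

  Tstar : RM
  Tstar = sumRM (map (λ p → δ (proj₁ p , ⊖F proj₂ p)) (glList k))

  IsRep : (MEl → MatR n) → Set
  IsRep σ = (σ (𝟙F , 𝟙F) ≡ 𝟙R) ×
            (∀ x y → InM x → InM y → σ (x ∙M y) ≡ σ x ⊗R σ y)

  σAlg : (MEl → MatR n) → RM → MatR n
  σAlg σ x = sumMR (map (λ m → x m ·R σ m) mList)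

  InI1 : (MEl → MatR n) → MatR n → Set
  InI1 σ f = ∀ m → InM m → f ⊗R σ m ≡ σ m ⊗R f

  -- I_w = Hom_𝓜(V^w , V), where V^w has action m ↦ σ(w m w⁻¹)
  InIw : (MEl → MatR n) → MatR n → Set
  InIw σ f = ∀ m → InM m → f ⊗R σ (conjW m) ≡ σ m ⊗R f

module Submission where

-- (i) The coefficient of m ∈ M in (T*)² is Σ_{g,h} [diag(gh , g⁻¹h⁻¹) = m], a sum
--     over g ∈ GL_k(F_q) of a function Φ_m(g) invariant under g ↦ s g (s ∈ F_q^×).
--     Normalising the leading entry of the first row of g to 1 splits GL_k(F_q)
--     into q - 1 translates of one transversal, so the coefficient is (q - 1) times
--     a sum, and vanishes when the characteristic ℓ divides q - 1.
-- (ii) T = σ(T*) = Σ_g σ(g , -g⁻¹) satisfies T σ(w m w⁻¹) = σ(m) T: reindex the sum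
--     along g ↦ a⁻¹ g b for m = diag(a , b). Hence T ∈ I_w, and a product of
--     intertwiners is an intertwiner for the composed twist, so T f ∈ I_w for
--     f ∈ I₁ and T f ∈ I₁ for f ∈ I_w. That T commutes with f follows by moving f
--     past each summand; for f ∈ I_w this twists the summands by w, which the
--     reindexing g ↦ -g⁻¹ undoes.

open import Defs
open import Data.Nat using (ℕ; _≥_; _∸_; _^_)
open import Data.Nat.Divisibility using (_∣_)
open import Data.Nat.Primality using (Prime)
open import Data.Product using (Σ; ∃; _×_)
open import Relation.Binary.PropositionalEquality using (_≡_; _≢_)

open import Level using (0ℓ)
open import Function using (_∘_; _⇔_; mk⇔)
open import Data.Empty using (⊥-elim)
open import Data.Product using (_,_; proj₁; proj₂)
open import Data.Nat as ℕ using (zero; suc; s≤s; z≤n)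
open import Data.Nat.Divisibility using (divides)
open import Data.Fin as Fin using (Fin)
open import Data.List as List
  using (List; []; _∷_; _++_; map; foldr; length; concatMap; filter; cartesianProduct; cartesianProductWith)
open import Data.List.Properties using (map-∘; filter-accept; filter-reject; filter-all)
open import Data.List.Membership.Propositional using (_∈_)
open import Data.List.Membership.Propositional.Properties
  using (∈-map⁺; ∈-map⁻; ∈-allFin; ∈-cartesianProductWith⁺; ∈-cartesianProduct⁺; ∈-filter⁺; ∈-filter⁻)
open import Data.List.Membership.Propositional.Properties.WithK using (unique∧set⇒bag)
open import Data.List.Relation.Unary.Any using (here; there)
open import Data.List.Relation.Unary.All as All using ()
open import Data.List.Relation.Unary.AllPairs using ([]; _∷_)
open import Data.List.Relation.Unary.Unique.Propositional using (Unique)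
open import Data.List.Relation.Unary.Unique.Propositional.Properties
  using (allFin⁺; cartesianProductWith⁺; cartesianProduct⁺; filter⁺)
open import Data.List.Relation.Binary.BagAndSetEquality using (∼bag⇒↭)
open import Data.List.Relation.Binary.Permutation.Propositional using (↭⇒↭ₛ)
import Data.List.Relation.Binary.Permutation.Propositional.Properties as Perm
import Data.List.Relation.Binary.Permutation.Setoid.Properties as PermSetoid
import Data.Vec as Vec
open import Data.Vec using (Vec)
open import Data.Vec.Properties using (lookup∘tabulate; tabulate∘lookup; tabulate-cong; toList-map; ∷-injective)
open import Relation.Binary.PropositionalEquality using (refl; sym; trans; cong; cong₂; subst; setoid; isEquivalence; module ≡-Reasoning)
open import Relation.Nullary using (Dec; yes; no; ¬_; ¬?)
open import Algebra.Core using (Op₂)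
open import Algebra.Bundles using (CommutativeMonoid; CommutativeRing)
open import Algebra.Structures using (IsCommutativeMonoid; IsCommutativeRing)
open import Algebra.Structures.Biased using (isCommutativeMonoidˡ)
import Algebra.Properties.CommutativeSemigroup as CommSemigroupProperties
import Algebra.Properties.Ring as RingProperties

module _ {C D : Set} {_∙_ : Op₂ C} {ε : C} {_◦_ : Op₂ D} {ε′ : D}
         (h : C → D) (h-ε : h ε ≡ ε′) (h-∙ : ∀ x y → h (x ∙ y) ≡ h x ◦ h y) where

  sum-homo : ∀ {A : Set} (f : A → C) xs →
             h (foldr _∙_ ε (map f xs)) ≡ foldr _◦_ ε′ (map (h ∘ f) xs)
  sum-homo f []       = h-ε
  sum-homo f (x ∷ xs) = trans (h-∙ (f x) _) (cong (h (f x) ◦_) (sum-homo f xs))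

map-unique : ∀ {A B : Set} (f : A → B) {xs : List A} →
             (∀ {x y} → x ∈ xs → y ∈ xs → f x ≡ f y → x ≡ y) →
             Unique xs → Unique (map f xs)
map-unique f inj [] = []
map-unique f {x ∷ xs} inj (x∉ ∷ u) =
  All.tabulate fresh ∷ map-unique f (λ p q → inj (there p) (there q)) u
  where
  fresh : ∀ {w} → w ∈ map f xs → f x ≢ w
  fresh w∈ fx≡w with ∈-map⁻ f w∈
  ... | y , y∈ , refl = All.lookup x∉ y∈ (inj (here refl) (there y∈) fx≡w)

module FiniteSums {C : Set} {_∙_ : Op₂ C} {ε : C}
                  (isCM : IsCommutativeMonoid _≡_ _∙_ ε) where

  open IsCommutativeMonoid isCM using (identityˡ; identityʳ)
  private
    monoid : CommutativeMonoid 0ℓ 0ℓ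
    monoid = record { isCommutativeMonoid = isCM }
  open CommSemigroupProperties (CommutativeMonoid.commutativeSemigroup monoid) using (interchange)
  open PermSetoid (setoid C) using (foldr-commMonoid)

  Sum : List C → C
  Sum = foldr _∙_ ε

  module _ {A : Set} where

    sum-cong : ∀ (f g : A → C) xs → (∀ x → x ∈ xs → f x ≡ g x) →
               Sum (map f xs) ≡ Sum (map g xs)
    sum-cong f g []       h = refl
    sum-cong f g (x ∷ xs) h = cong₂ _∙_ (h x (here refl)) (sum-cong f g xs (λ y → h y ∘ there))

    sum-ε : ∀ (f : A → C) xs → (∀ x → x ∈ xs → f x ≡ ε) → Sum (map f xs) ≡ ε
    sum-ε f []       h = refl
    sum-ε f (x ∷ xs) h = trans (cong₂ _∙_ (h x (here refl)) (sum-ε f xs (λ y → h y ∘ there))) (identityˡ ε)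

    sum-∙ : ∀ (f g : A → C) xs →
            Sum (map (λ x → f x ∙ g x) xs) ≡ Sum (map f xs) ∙ Sum (map g xs)
    sum-∙ f g []       = sym (identityˡ ε)
    sum-∙ f g (x ∷ xs) = trans (cong ((f x ∙ g x) ∙_) (sum-∙ f g xs)) (interchange _ _ _ _)

    sift : ∀ (f : A → C) t {xs} → Unique xs → t ∈ xs → (∀ x → x ≢ t → f x ≡ ε) →
           Sum (map f xs) ≡ f t
    sift f t {x ∷ xs} (x∉ ∷ u) (here refl) h =
      trans (cong (f x ∙_) (sum-ε f xs (λ y y∈ → h y (λ y≡x → All.lookup x∉ y∈ (sym y≡x)))))
            (identityʳ (f x))
    sift f t {x ∷ xs} (x∉ ∷ u) (there t∈) h =
      trans (cong₂ _∙_ (h x (All.lookup x∉ t∈)) (sift f t u t∈ h)) (identityˡ (f t))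

    sum-reorder : ∀ (f : A → C) {xs ys} → Unique xs → Unique ys →
                  (∀ {z} → z ∈ xs ⇔ z ∈ ys) → Sum (map f xs) ≡ Sum (map f ys)
    sum-reorder f ux uy same =
      foldr-commMonoid isCM (↭⇒↭ₛ (Perm.map⁺ f (∼bag⇒↭ (unique∧set⇒bag ux uy same))))

    reindex : ∀ (f : A → C) (φ ψ : A → A) {xs} → Unique xs →
              (∀ {x} → x ∈ xs → φ x ∈ xs) → (∀ {x} → x ∈ xs → ψ x ∈ xs) →
              (∀ {x} → x ∈ xs → ψ (φ x) ≡ x) → (∀ {x} → x ∈ xs → φ (ψ x) ≡ x) →
              Sum (map (f ∘ φ) xs) ≡ Sum (map f xs)
    reindex f φ ψ {xs} u φ∈ ψ∈ ψφ φψ =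
      trans (cong Sum (map-∘ xs)) (sum-reorder f (map-unique φ φ-inj u) u (mk⇔ to from))
      where
      φ-inj : ∀ {x y} → x ∈ xs → y ∈ xs → φ x ≡ φ y → x ≡ y
      φ-inj x∈ y∈ eq = trans (sym (ψφ x∈)) (trans (cong ψ eq) (ψφ y∈))
      to : ∀ {z} → z ∈ map φ xs → z ∈ xs
      to z∈ with ∈-map⁻ φ z∈
      ... | y , y∈ , refl = φ∈ y∈
      from : ∀ {z} → z ∈ xs → z ∈ map φ xs
      from z∈ = subst (_∈ map φ xs) (φψ z∈) (∈-map⁺ φ (ψ∈ z∈))

  sum-swap : ∀ {A B : Set} (f : A → B → C) xs ys →
             Sum (map (λ x → Sum (map (f x) ys)) xs) ≡ Sum (map (λ y → Sum (map (λ x → f x y) xs)) ys)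
  sum-swap f []       ys = sym (sum-ε (λ _ → ε) ys (λ _ _ → refl))
  sum-swap f (x ∷ xs) ys =
    trans (cong (Sum (map (f x) ys) ∙_) (sum-swap f xs ys))
          (sym (sum-∙ (f x) (λ y → Sum (map (λ x′ → f x′ y) xs)) ys))

module LinearAlgebra (F : Field) where

  open Field F
  open FieldOps F
  open IsCommutativeRing isCommutativeRing
    using (+-isCommutativeMonoid; +-assoc; +-comm; +-identityˡ;
           *-assoc; *-comm; *-identityˡ; distribˡ; distribʳ; zeroˡ; zeroʳ)
  private
    commRing : CommutativeRing 0ℓ 0ℓ
    commRing = record { isCommutativeRing = isCommutativeRing }
  open RingProperties (CommutativeRing.ring commRing) using (-1*x≈-x; -‿involutive)
  open CommSemigroupProperties (CommutativeRing.*-commutativeSemigroup commRing) using (x∙yz≈y∙xz)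
  open FiniteSums +-isCommutativeMonoid public

  *-sumˡ : ∀ {A : Set} a (f : A → Carrier) xs → a * Sum (map f xs) ≡ Sum (map (λ x → a * f x) xs)
  *-sumˡ a = sum-homo (a *_) (zeroʳ a) (distribˡ a)

  *-sumʳ : ∀ {A : Set} a (f : A → Carrier) xs → Sum (map f xs) * a ≡ Sum (map (λ x → f x * a) xs)
  *-sumʳ a = sum-homo (_* a) (zeroˡ a) (λ x y → distribʳ a x y)

  sum-const : ∀ {A : Set} c (xs : List A) → Sum (map (λ _ → c) xs) ≡ fromℕ (length xs) * c
  sum-const c []       = sym (zeroˡ c)
  sum-const c (x ∷ xs) = trans (cong₂ _+_ (sym (*-identityˡ c)) (sum-const c xs)) (sym (distribʳ c 1# _))

  fromℕ-+ : ∀ m n → fromℕ (m ℕ.+ n) ≡ fromℕ m + fromℕ n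
  fromℕ-+ zero    n = sym (+-identityˡ _)
  fromℕ-+ (suc m) n = trans (cong (1# +_) (fromℕ-+ m n)) (sym (+-assoc _ _ _))

  fromℕ-* : ∀ m n → fromℕ (m ℕ.* n) ≡ fromℕ m * fromℕ n
  fromℕ-* zero    n = sym (zeroˡ _)
  fromℕ-* (suc m) n = trans (fromℕ-+ n (m ℕ.* n))
    (trans (cong₂ _+_ (sym (*-identityˡ _)) (fromℕ-* m n)) (sym (distribʳ _ 1# _)))

  char-multiple : ∀ {ℓ m} → HasChar ℓ → ℓ ∣ m → fromℕ m ≡ 0#
  char-multiple {ℓ} (_ , ℓ≡0 , _) (divides c refl) =
    trans (fromℕ-* c ℓ) (trans (cong (fromℕ c *_) ℓ≡0) (zeroʳ (fromℕ c)))

  indices : (n : ℕ) → List (Fin n)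
  indices n = Vec.toList (Vec.allFin n)

  toList-tabulate : ∀ {A : Set} n (f : Fin n → A) → Vec.toList (Vec.tabulate f) ≡ List.tabulate f
  toList-tabulate zero    f = refl
  toList-tabulate (suc n) f = cong (f Fin.zero ∷_) (toList-tabulate n (f ∘ Fin.suc))

  indices-unique : ∀ n → Unique (indices n)
  indices-unique n = subst Unique (sym (toList-tabulate n (λ i → i))) (allFin⁺ n)

  indices-complete : ∀ {n} (i : Fin n) → i ∈ indices n
  indices-complete {n} i = subst (i ∈_) (sym (toList-tabulate n (λ i → i))) (∈-allFin i)

  ∑ : ∀ n → (Fin n → Carrier) → Carrier
  ∑ n g = Sum (map g (indices n))

  ∑-cong : ∀ {n} {f g : Fin n → Carrier} → (∀ i → f i ≡ g i) → ∑ n f ≡ ∑ n g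
  ∑-cong {n} {f} {g} h = sum-cong f g (indices n) (λ i _ → h i)

  entry-mk : ∀ {n} {f : Fin n → Fin n → Carrier} i j → entry (mkMat f) i j ≡ f i j
  entry-mk {f = f} i j rewrite lookup∘tabulate (λ i → Vec.tabulate (f i)) i = lookup∘tabulate (f i) j

  -- stated for any M given as mkMat f, so that f is found by unification
  entry-of : ∀ {n} {M : Mat n} (f : Fin n → Fin n → Carrier) → M ≡ mkMat f → ∀ i j → entry M i j ≡ f i j
  entry-of f refl = entry-mk

  mat-ext : ∀ {n} {A B : Mat n} → (∀ i j → entry A i j ≡ entry B i j) → A ≡ B
  mat-ext {A = A} {B} h =
    trans (sym (rows A)) (trans (tabulate-cong (λ i → tabulate-cong (h i))) (rows B))
    where
    rows : ∀ M → mkMat (entry M) ≡ M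
    rows M = trans (tabulate-cong (λ i → tabulate∘lookup (Vec.lookup M i))) (tabulate∘lookup M)

  entry-⊗ : ∀ {n} (A B : Mat n) i j → entry (A ⊗ B) i j ≡ ∑ n (λ l → entry A i l * entry B l j)
  entry-⊗ {n} A B i j = trans (entry-mk i j) (cong Sum (toList-map _ (Vec.allFin n)))

  𝟙-off : ∀ {n} (i j : Fin n) → i ≢ j → entry (𝟙 {n}) i j ≡ 0#
  𝟙-off i j i≢j rewrite entry-of {M = 𝟙} _ refl i j with i Fin.≟ j
  ... | yes i≡j = ⊥-elim (i≢j i≡j)
  ... | no  _   = refl

  𝟙-diag : ∀ {n} (i : Fin n) → entry (𝟙 {n}) i i ≡ 1#
  𝟙-diag i rewrite entry-of {M = 𝟙} _ refl i i with i Fin.≟ i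
  ... | yes _   = refl
  ... | no  i≢i = ⊥-elim (i≢i refl)

  ⊗-identityʳ : ∀ {n} (A : Mat n) → A ⊗ 𝟙 ≡ A
  ⊗-identityʳ {n} A = mat-ext λ i j → begin
    entry (A ⊗ 𝟙) i j                     ≡⟨ entry-⊗ A 𝟙 i j ⟩
    ∑ n (λ l → entry A i l * entry 𝟙 l j)  ≡⟨ sift _ j (indices-unique n) (indices-complete j)
                                               (λ l l≢j → trans (cong (entry A i l *_) (𝟙-off l j l≢j)) (zeroʳ _)) ⟩
    entry A i j * entry 𝟙 j j              ≡⟨ cong (entry A i j *_) (𝟙-diag j) ⟩
    entry A i j * 1#                       ≡⟨ *-comm _ 1# ⟩
    1# * entry A i j                       ≡⟨ *-identityˡ _ ⟩
    entry A i j                            ∎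
    where open ≡-Reasoning

  ⊗-identityˡ : ∀ {n} (A : Mat n) → 𝟙 ⊗ A ≡ A
  ⊗-identityˡ {n} A = mat-ext λ i j → begin
    entry (𝟙 ⊗ A) i j                     ≡⟨ entry-⊗ 𝟙 A i j ⟩
    ∑ n (λ l → entry 𝟙 i l * entry A l j)  ≡⟨ sift _ i (indices-unique n) (indices-complete i)
                                               (λ l l≢i → trans (cong (_* entry A l j) (𝟙-off i l (l≢i ∘ sym))) (zeroˡ _)) ⟩
    entry 𝟙 i i * entry A i j              ≡⟨ cong (_* entry A i j) (𝟙-diag i) ⟩
    1# * entry A i j                       ≡⟨ *-identityˡ _ ⟩
    entry A i j                            ∎
    where open ≡-Reasoning

  ⊗-assoc : ∀ {n} (A B C : Mat n) → (A ⊗ B) ⊗ C ≡ A ⊗ (B ⊗ C)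
  ⊗-assoc {n} A B C = mat-ext λ i j → begin
    entry ((A ⊗ B) ⊗ C) i j
      ≡⟨ entry-⊗ (A ⊗ B) C i j ⟩
    ∑ n (λ l → entry (A ⊗ B) i l * entry C l j)
      ≡⟨ ∑-cong (λ l → trans (cong (_* entry C l j) (entry-⊗ A B i l)) (*-sumʳ _ _ (indices n))) ⟩
    ∑ n (λ l → ∑ n (λ m → entry A i m * entry B m l * entry C l j))
      ≡⟨ sum-swap (λ l m → entry A i m * entry B m l * entry C l j) (indices n) (indices n) ⟩
    ∑ n (λ m → ∑ n (λ l → entry A i m * entry B m l * entry C l j))
      ≡⟨ ∑-cong (λ m → trans (∑-cong (λ l → *-assoc (entry A i m) (entry B m l) (entry C l j)))
                                  (sym (*-sumˡ _ _ (indices n)))) ⟩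
    ∑ n (λ m → entry A i m * ∑ n (λ l → entry B m l * entry C l j))
      ≡⟨ ∑-cong (λ m → cong (entry A i m *_) (sym (entry-⊗ B C m j))) ⟩
    ∑ n (λ m → entry A i m * entry (B ⊗ C) m j)
      ≡⟨ entry-⊗ A (B ⊗ C) i j ⟨
    entry (A ⊗ (B ⊗ C)) i j
      ∎
    where open ≡-Reasoning

  ·-⊗ : ∀ {n} a (A B : Mat n) → (a · A) ⊗ B ≡ a · (A ⊗ B)
  ·-⊗ {n} a A B = mat-ext λ i j → begin
    entry ((a · A) ⊗ B) i j                       ≡⟨ entry-⊗ (a · A) B i j ⟩
    ∑ n (λ l → entry (a · A) i l * entry B l j)   ≡⟨ ∑-cong (λ l → trans (cong (_* entry B l j) (entry-mk i l))
                                                                          (*-assoc _ _ _)) ⟩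
    ∑ n (λ l → a * (entry A i l * entry B l j))   ≡⟨ *-sumˡ a _ (indices n) ⟨
    a * ∑ n (λ l → entry A i l * entry B l j)     ≡⟨ cong (a *_) (entry-⊗ A B i j) ⟨
    a * entry (A ⊗ B) i j                         ≡⟨ entry-mk i j ⟨
    entry (a · (A ⊗ B)) i j                       ∎
    where open ≡-Reasoning

  ⊗-· : ∀ {n} b (A B : Mat n) → A ⊗ (b · B) ≡ b · (A ⊗ B)
  ⊗-· {n} b A B = mat-ext λ i j → begin
    entry (A ⊗ (b · B)) i j                       ≡⟨ entry-⊗ A (b · B) i j ⟩
    ∑ n (λ l → entry A i l * entry (b · B) l j)   ≡⟨ ∑-cong (λ l → trans (cong (entry A i l *_) (entry-mk l j))
                                                                          (x∙yz≈y∙xz _ _ _)) ⟩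
    ∑ n (λ l → b * (entry A i l * entry B l j))   ≡⟨ *-sumˡ b _ (indices n) ⟨
    b * ∑ n (λ l → entry A i l * entry B l j)     ≡⟨ cong (b *_) (entry-⊗ A B i j) ⟨
    b * entry (A ⊗ B) i j                         ≡⟨ entry-mk i j ⟨
    entry (b · (A ⊗ B)) i j                       ∎
    where open ≡-Reasoning

  ·-assoc : ∀ {n} a b (A : Mat n) → a · (b · A) ≡ (a * b) · A
  ·-assoc a b A = mat-ext λ i j →
    trans (entry-mk i j) (trans (cong (a *_) (entry-mk i j)) (trans (sym (*-assoc a b _)) (sym (entry-mk i j))))

  ·⊗· : ∀ {n} a b (A B : Mat n) → (a · A) ⊗ (b · B) ≡ (a * b) · (A ⊗ B)
  ·⊗· a b A B = trans (·-⊗ a A (b · B)) (trans (cong (a ·_) (⊗-· b A B)) (·-assoc a b (A ⊗ B)))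

  ·-identity : ∀ {n} (A : Mat n) → 1# · A ≡ A
  ·-identity A = mat-ext λ i j → trans (entry-mk i j) (*-identityˡ _)

  ·-zero : ∀ {n} (A : Mat n) → 0# · A ≡ 𝟎
  ·-zero A = mat-ext λ i j → trans (entry-mk i j) (trans (zeroˡ _) (sym (entry-mk i j)))

  ·-distrib : ∀ {n} a b (A : Mat n) → (a + b) · A ≡ (a · A) ⊕ (b · A)
  ·-distrib a b A = mat-ext λ i j → trans (entry-mk i j)
    (trans (distribʳ _ a b) (sym (trans (entry-mk i j) (cong₂ _+_ (entry-mk i j) (entry-mk i j)))))

  ⊖-as-scalar : ∀ {n} (A : Mat n) → ⊖ A ≡ (- 1#) · A
  ⊖-as-scalar A = mat-ext λ i j → trans (entry-mk i j) (trans (sym (-1*x≈-x _)) (sym (entry-mk i j)))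

  ⊖-⊗ : ∀ {n} (A B : Mat n) → (⊖ A) ⊗ B ≡ ⊖ (A ⊗ B)
  ⊖-⊗ A B = trans (cong (_⊗ B) (⊖-as-scalar A)) (trans (·-⊗ (- 1#) A B) (sym (⊖-as-scalar (A ⊗ B))))

  ⊗-⊖ : ∀ {n} (A B : Mat n) → A ⊗ (⊖ B) ≡ ⊖ (A ⊗ B)
  ⊗-⊖ A B = trans (cong (A ⊗_) (⊖-as-scalar B)) (trans (⊗-· (- 1#) A B) (sym (⊖-as-scalar (A ⊗ B))))

  ⊖-involutive : ∀ {n} (A : Mat n) → ⊖ (⊖ A) ≡ A
  ⊖-involutive A = mat-ext λ i j → trans (entry-mk i j) (trans (cong -_ (entry-mk i j)) (-‿involutive _))

  ⊖⊗⊖ : ∀ {n} (A B : Mat n) → (⊖ A) ⊗ (⊖ B) ≡ A ⊗ B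
  ⊖⊗⊖ A B = trans (⊖-⊗ A (⊖ B)) (trans (cong ⊖_ (⊗-⊖ A B)) (⊖-involutive (A ⊗ B)))

  ⊕-isCommutativeMonoid : ∀ {n} → IsCommutativeMonoid _≡_ (_⊕_ {n}) 𝟎
  ⊕-isCommutativeMonoid = isCommutativeMonoidˡ record
    { isSemigroup = record
      { isMagma = record { isEquivalence = isEquivalence ; ∙-cong = cong₂ _⊕_ }
      ; assoc   = λ A B C → mat-ext λ i j → trans (entry-mk i j) (trans (cong (_+ _) (entry-mk i j))
                    (trans (+-assoc _ _ _) (sym (trans (entry-mk i j) (cong (_ +_) (entry-mk i j))))))
      }
    ; identityˡ = λ A → mat-ext λ i j → trans (entry-mk i j) (trans (cong (_+ _) (entry-mk i j)) (+-identityˡ _))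
    ; comm      = λ A B → mat-ext λ i j → trans (entry-mk i j) (trans (+-comm _ _) (sym (entry-mk i j)))
    }

  module MatSums {n : ℕ} = FiniteSums (⊕-isCommutativeMonoid {n})

  ⊕-⊗ : ∀ {n} (A B C : Mat n) → (A ⊕ B) ⊗ C ≡ (A ⊗ C) ⊕ (B ⊗ C)
  ⊕-⊗ {n} A B C = mat-ext λ i j → begin
    entry ((A ⊕ B) ⊗ C) i j
      ≡⟨ entry-⊗ (A ⊕ B) C i j ⟩
    ∑ n (λ l → entry (A ⊕ B) i l * entry C l j)
      ≡⟨ ∑-cong (λ l → trans (cong (_* entry C l j) (entry-mk i l)) (distribʳ _ _ _)) ⟩
    ∑ n (λ l → entry A i l * entry C l j + entry B i l * entry C l j)
      ≡⟨ sum-∙ _ _ (indices n) ⟩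
    ∑ n (λ l → entry A i l * entry C l j) + ∑ n (λ l → entry B i l * entry C l j)
      ≡⟨ cong₂ _+_ (entry-⊗ A C i j) (entry-⊗ B C i j) ⟨
    entry (A ⊗ C) i j + entry (B ⊗ C) i j
      ≡⟨ entry-mk i j ⟨
    entry ((A ⊗ C) ⊕ (B ⊗ C)) i j
      ∎
    where open ≡-Reasoning

  ⊗-⊕ : ∀ {n} (A B C : Mat n) → A ⊗ (B ⊕ C) ≡ (A ⊗ B) ⊕ (A ⊗ C)
  ⊗-⊕ {n} A B C = mat-ext λ i j → begin
    entry (A ⊗ (B ⊕ C)) i j
      ≡⟨ entry-⊗ A (B ⊕ C) i j ⟩
    ∑ n (λ l → entry A i l * entry (B ⊕ C) l j)
      ≡⟨ ∑-cong (λ l → trans (cong (entry A i l *_) (entry-mk l j)) (distribˡ _ _ _)) ⟩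
    ∑ n (λ l → entry A i l * entry B l j + entry A i l * entry C l j)
      ≡⟨ sum-∙ _ _ (indices n) ⟩
    ∑ n (λ l → entry A i l * entry B l j) + ∑ n (λ l → entry A i l * entry C l j)
      ≡⟨ cong₂ _+_ (entry-⊗ A B i j) (entry-⊗ A C i j) ⟨
    entry (A ⊗ B) i j + entry (A ⊗ C) i j
      ≡⟨ entry-mk i j ⟨
    entry ((A ⊗ B) ⊕ (A ⊗ C)) i j
      ∎
    where open ≡-Reasoning

  𝟎-⊗ : ∀ {n} (C : Mat n) → 𝟎 ⊗ C ≡ 𝟎
  𝟎-⊗ {n} C = mat-ext λ i j → trans (entry-⊗ 𝟎 C i j)
    (trans (sum-ε _ (indices n) (λ l _ → trans (cong (_* entry C l j) (entry-mk i l)) (zeroˡ _)))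
           (sym (entry-mk i j)))

  ⊗-𝟎 : ∀ {n} (C : Mat n) → C ⊗ 𝟎 ≡ 𝟎
  ⊗-𝟎 {n} C = mat-ext λ i j → trans (entry-⊗ C 𝟎 i j)
    (trans (sum-ε _ (indices n) (λ l _ → trans (cong (entry C i l *_) (entry-mk l j)) (zeroʳ _)))
           (sym (entry-mk i j)))

  sumM-⊗ : ∀ {A : Set} {n} (f : A → Mat n) C xs → sumM (map f xs) ⊗ C ≡ sumM (map (λ x → f x ⊗ C) xs)
  sumM-⊗ f C = sum-homo (_⊗ C) (𝟎-⊗ C) (λ A B → ⊕-⊗ A B C) f

  ⊗-sumM : ∀ {A : Set} {n} (f : A → Mat n) C xs → C ⊗ sumM (map f xs) ≡ sumM (map (λ x → C ⊗ f x) xs)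
  ⊗-sumM f C = sum-homo (C ⊗_) (⊗-𝟎 C) (⊗-⊕ C) f

  sum-· : ∀ {A : Set} {n} (g : A → Carrier) (M : Mat n) xs → Sum (map g xs) · M ≡ sumM (map (λ x → g x · M) xs)
  sum-· g M = sum-homo (_· M) (·-zero M) (λ a b → ·-distrib a b M) g

allVecs-suc : ∀ {A : Set} (xs : List A) n →
              allVecs xs (suc n) ≡ cartesianProductWith Vec._∷_ xs (allVecs xs n)
allVecs-suc xs n = go xs
  where
  go : ∀ ys → concatMap (λ y → map (y Vec.∷_) (allVecs xs n)) ys
            ≡ cartesianProductWith Vec._∷_ ys (allVecs xs n)
  go []       = refl
  go (y ∷ ys) = cong (map (y Vec.∷_) (allVecs xs n) ++_) (go ys)

allVecs-complete : ∀ {A : Set} {xs : List A} → (∀ x → x ∈ xs) → ∀ n (v : Vec A n) → v ∈ allVecs xs n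
allVecs-complete all zero    Vec.[]       = here refl
allVecs-complete {xs = xs} all (suc n) (x Vec.∷ v) =
  subst (_ ∈_) (sym (allVecs-suc xs n))
        (∈-cartesianProductWith⁺ Vec._∷_ (all x) (allVecs-complete all n v))

allVecs-unique : ∀ {A : Set} {xs : List A} → Unique xs → ∀ n → Unique (allVecs xs n)
allVecs-unique u zero = All.[] ∷ []
allVecs-unique {xs = xs} u (suc n) =
  subst Unique (sym (allVecs-suc xs n))
        (cartesianProductWith⁺ Vec._∷_ ∷-injective u (allVecs-unique u n))

module GeneralLinear (Fq : FiniteField) where

  open FiniteField Fq using (fld; elems; complete; unique)
  open FFMat Fq
  open Field fld using (_*_; 1#; isCommutativeRing)
  open IsCommutativeRing isCommutativeRing using (*-comm)
  open LinearAlgebra fld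
    using (⊗-assoc; ⊗-identityˡ; ⊗-identityʳ; ⊖⊗⊖; ⊖-involutive; ·⊗·; ·-assoc; ·-identity)

  Inverses : ∀ {k} → Mat k × Mat k → Set
  Inverses (a , b) = (a ⊗ b ≡ 𝟙) × (b ⊗ a ≡ 𝟙)

  allMats-complete : ∀ k (A : Mat k) → A ∈ allMats k
  allMats-complete k = allVecs-complete (allVecs-complete complete k) k

  allMats-unique : ∀ k → Unique (allMats k)
  allMats-unique k = allVecs-unique (allVecs-unique unique k) k

  gl-complete : ∀ {k} {x : Mat k × Mat k} → Inverses x → x ∈ glList k
  gl-complete {k} {a , b} inv =
    ∈-filter⁺ _ (∈-cartesianProduct⁺ (allMats-complete k a) (allMats-complete k b)) inv

  gl-sound : ∀ {k} {x : Mat k × Mat k} → x ∈ glList k → Inverses x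
  gl-sound {k} x∈ = proj₂ (∈-filter⁻ _ {xs = cartesianProduct (allMats k) (allMats k)} x∈)

  gl-unique : ∀ k → Unique (glList k)
  gl-unique k = filter⁺ _ (cartesianProduct⁺ (allMats-unique k) (allMats-unique k))

  inverse-unique : ∀ {k} (a b c : Mat k) → b ⊗ a ≡ 𝟙 → a ⊗ c ≡ 𝟙 → b ≡ c
  inverse-unique a b c ba≡𝟙 ac≡𝟙 = begin
    b              ≡⟨ ⊗-identityʳ b ⟨
    b ⊗ 𝟙          ≡⟨ cong (b ⊗_) ac≡𝟙 ⟨
    b ⊗ (a ⊗ c)    ≡⟨ ⊗-assoc b a c ⟨
    (b ⊗ a) ⊗ c    ≡⟨ cong (_⊗ c) ba≡𝟙 ⟩
    𝟙 ⊗ c          ≡⟨ ⊗-identityˡ c ⟩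
    c              ∎
    where open ≡-Reasoning

  inverse-pair-ext : ∀ {k} {x y : Mat k × Mat k} → Inverses x → Inverses y → proj₁ x ≡ proj₁ y → x ≡ y
  inverse-pair-ext {x = a , b} {.a , c} (_ , ba≡𝟙) (ac≡𝟙 , _) refl = cong (a ,_) (inverse-unique a b c ba≡𝟙 ac≡𝟙)

  glMats : ∀ k → List (Mat k)
  glMats k = map proj₁ (glList k)

  glMats-unique : ∀ k → Unique (glMats k)
  glMats-unique k = map-unique proj₁ first-determines (gl-unique k)
    where
    first-determines : ∀ {x y} → x ∈ glList k → y ∈ glList k → proj₁ x ≡ proj₁ y → x ≡ y
    first-determines x∈ y∈ = inverse-pair-ext (gl-sound x∈) (gl-sound y∈)

  glMats-complete : ∀ {k} (a : Mat k) → IsGL a → a ∈ glMats k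
  glMats-complete a (b , inv) = ∈-map⁺ proj₁ (gl-complete {x = a , b} inv)

  cancel-left : ∀ {k} (a a′ y : Mat k) → a ⊗ a′ ≡ 𝟙 → a ⊗ (a′ ⊗ y) ≡ y
  cancel-left a a′ y aa′≡𝟙 = trans (sym (⊗-assoc a a′ y)) (trans (cong (_⊗ y) aa′≡𝟙) (⊗-identityˡ y))

  sandwich-cancel : ∀ {k} (p p′ x q q′ : Mat k) → p′ ⊗ p ≡ 𝟙 → q ⊗ q′ ≡ 𝟙 →
                    (p′ ⊗ ((p ⊗ x) ⊗ q)) ⊗ q′ ≡ x
  sandwich-cancel p p′ x q q′ p′p≡𝟙 qq′≡𝟙 = begin
    (p′ ⊗ ((p ⊗ x) ⊗ q)) ⊗ q′   ≡⟨ cong (_⊗ q′) (⊗-assoc p′ (p ⊗ x) q) ⟨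
    ((p′ ⊗ (p ⊗ x)) ⊗ q) ⊗ q′   ≡⟨ ⊗-assoc (p′ ⊗ (p ⊗ x)) q q′ ⟩
    (p′ ⊗ (p ⊗ x)) ⊗ (q ⊗ q′)   ≡⟨ cong₂ _⊗_ (sym (⊗-assoc p′ p x)) qq′≡𝟙 ⟩
    ((p′ ⊗ p) ⊗ x) ⊗ 𝟙          ≡⟨ ⊗-identityʳ ((p′ ⊗ p) ⊗ x) ⟩
    (p′ ⊗ p) ⊗ x                ≡⟨ cong (_⊗ x) p′p≡𝟙 ⟩
    𝟙 ⊗ x                       ≡⟨ ⊗-identityˡ x ⟩
    x                           ∎
    where open ≡-Reasoning

  product-inverse : ∀ {k} (a a′ b b′ : Mat k) → a ⊗ a′ ≡ 𝟙 → b ⊗ b′ ≡ 𝟙 → (a ⊗ b) ⊗ (b′ ⊗ a′) ≡ 𝟙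
  product-inverse a a′ b b′ aa′≡𝟙 bb′≡𝟙 = begin
    (a ⊗ b) ⊗ (b′ ⊗ a′)   ≡⟨ ⊗-assoc a b (b′ ⊗ a′) ⟩
    a ⊗ (b ⊗ (b′ ⊗ a′))   ≡⟨ cong (a ⊗_) (⊗-assoc b b′ a′) ⟨
    a ⊗ ((b ⊗ b′) ⊗ a′)   ≡⟨ cong (λ y → a ⊗ (y ⊗ a′)) bb′≡𝟙 ⟩
    a ⊗ (𝟙 ⊗ a′)          ≡⟨ cong (a ⊗_) (⊗-identityˡ a′) ⟩
    a ⊗ a′                ≡⟨ aa′≡𝟙 ⟩
    𝟙                     ∎
    where open ≡-Reasoning

  -- a permutation of the set of inverse pairs, i.e. of GL_k(F_q); being mutually
  -- inverse only needs checking on first components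
  record GLPermutation (k : ℕ) : Set where
    field
      to from  : Mat k × Mat k → Mat k × Mat k
      to-inv   : ∀ {x} → Inverses x → Inverses (to x)
      from-inv : ∀ {x} → Inverses x → Inverses (from x)
      from-to  : ∀ {x} → Inverses x → proj₁ (from (to x)) ≡ proj₁ x
      to-from  : ∀ {x} → Inverses x → proj₁ (to (from x)) ≡ proj₁ x

  module _ {C : Set} {_∙_ : Op₂ C} {ε : C} (isCM : IsCommutativeMonoid _≡_ _∙_ ε) where
    open FiniteSums isCM using (Sum; reindex)

    sum-gl-invariant : ∀ {k} (π : GLPermutation k) (f : Mat k × Mat k → C) →
                       Sum (map (f ∘ GLPermutation.to π) (glList k)) ≡ Sum (map f (glList k))
    sum-gl-invariant {k} π f =
      reindex f to from (gl-unique k) (gl-complete ∘ to-inv ∘ gl-sound) (gl-complete ∘ from-inv ∘ gl-sound)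
              (λ x∈ → let x-inv = gl-sound x∈ in inverse-pair-ext (from-inv (to-inv x-inv)) x-inv (from-to x-inv))
              (λ x∈ → let x-inv = gl-sound x∈ in inverse-pair-ext (to-inv (from-inv x-inv)) x-inv (to-from x-inv))
      where open GLPermutation π

  translation : ∀ {k} (u v : Mat k × Mat k) → Inverses u → Inverses v → GLPermutation k
  translation (u , u′) (v , v′) (uu′ , u′u) (vv′ , v′v) = record
    { to       = λ { (x , x′) → ((u ⊗ x) ⊗ v , v′ ⊗ (x′ ⊗ u′)) }
    ; from     = λ { (x , x′) → ((u′ ⊗ x) ⊗ v′ , v ⊗ (x′ ⊗ u)) }
    ; to-inv   = λ { {x , x′} (xx′ , x′x) →
                   product-inverse (u ⊗ x) (x′ ⊗ u′) v v′ (product-inverse u u′ x x′ uu′ xx′) vv′ ,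
                   product-inverse v′ v (x′ ⊗ u′) (u ⊗ x) v′v (product-inverse x′ x u′ u x′x u′u) }
    ; from-inv = λ { {x , x′} (xx′ , x′x) →
                   product-inverse (u′ ⊗ x) (x′ ⊗ u) v′ v (product-inverse u′ u x x′ u′u xx′) v′v ,
                   product-inverse v v′ (x′ ⊗ u) (u′ ⊗ x) vv′ (product-inverse x′ x u u′ x′x uu′) }
    ; from-to  = λ {x} _ → sandwich-cancel u u′ (proj₁ x) v v′ u′u vv′
    ; to-from  = λ {x} _ → sandwich-cancel u′ u (proj₁ x) v′ v uu′ v′v
    }

  negated-inverse : ∀ {k} → GLPermutation k
  negated-inverse = record
    { to       = swap-negate
    ; from     = swap-negate
    ; to-inv   = λ {x} → negate-inverses {x = x}
    ; from-inv = λ {x} → negate-inverses {x = x}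
    ; from-to  = λ {x} _ → ⊖-involutive (proj₁ x)
    ; to-from  = λ {x} _ → ⊖-involutive (proj₁ x)
    }
    where
    swap-negate : ∀ {k} → Mat k × Mat k → Mat k × Mat k
    swap-negate (x , x′) = (⊖ x′ , ⊖ x)
    negate-inverses : ∀ {k} {x : Mat k × Mat k} → Inverses x → Inverses (swap-negate x)
    negate-inverses {x = x , x′} (xx′ , x′x) = trans (⊖⊗⊖ x′ x) x′x , trans (⊖⊗⊖ x x′) xx′

  scalars-cancel : ∀ {k} {s t} (A B : Mat k) → s * t ≡ 1# → (s · A) ⊗ (t · B) ≡ A ⊗ B
  scalars-cancel {s = s} {t} A B st≡1 =
    trans (·⊗· s t A B) (trans (cong (_· (A ⊗ B)) st≡1) (·-identity (A ⊗ B)))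

  scaling : ∀ {k} s t → s * t ≡ 1# → GLPermutation k
  scaling s t st≡1 = record
    { to       = λ { (x , x′) → (s · x , t · x′) }
    ; from     = λ { (x , x′) → (t · x , s · x′) }
    ; to-inv   = λ { {x , x′} (xx′ , x′x) → trans (scalars-cancel x x′ st≡1) xx′ ,
                                           trans (scalars-cancel x′ x ts≡1) x′x }
    ; from-inv = λ { {x , x′} (xx′ , x′x) → trans (scalars-cancel x x′ ts≡1) xx′ ,
                                           trans (scalars-cancel x′ x st≡1) x′x }
    ; from-to  = λ {x} _ → cancel t s ts≡1 (proj₁ x)
    ; to-from  = λ {x} _ → cancel s t st≡1 (proj₁ x)
    }
    where
    ts≡1 : t * s ≡ 1#
    ts≡1 = trans (*-comm t s) st≡1
    cancel : ∀ {k} a b → a * b ≡ 1# → (A : Mat k) → a · (b · A) ≡ A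
    cancel a b ab≡1 A = trans (·-assoc a b A) (trans (cong (_· A) ab≡1) (·-identity A))

module TStar (Fq : FiniteField) (R : Field) (k n : ℕ) where

  open Setting Fq R k n
  open GeneralLinear Fq
  open FFMat Fq using (glList) renaming (Mat to MatF; ⊖_ to ⊖F_)
  open Field R using () renaming (Carrier to RC; 0# to 0R; 1# to 1R; _*_ to _*R_; isCommutativeRing to R-ring)
  open IsCommutativeRing R-ring using () renaming (zeroˡ to *R-zeroˡ; *-identityˡ to *R-identityˡ)
  open FieldOps R using (sumM) renaming (Mat to MatR; _·_ to _·R_)
  open LinearAlgebra R using (Sum; sum-cong; sum-swap; sift; *-sumʳ; sum-·; ·-zero; ·-identity; module MatSums)

  gl : List (MatF k × MatF k)
  gl = glList k

  summand : MatF k × MatF k → MEl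
  summand (g , g′) = (g , ⊖F g′)

  mList-unique : Unique mList
  mList-unique = cartesianProduct⁺ (glMats-unique k) (glMats-unique k)

  InM⇒∈mList : ∀ m → InM m → m ∈ mList
  InM⇒∈mList (a , b) (a-inv , b-inv) = ∈-cartesianProduct⁺ (glMats-complete a a-inv) (glMats-complete b b-inv)

  summand-InM : ∀ {x} → Inverses x → InM (summand x)
  summand-InM {g , g′} inv = (g′ , inv) , (⊖F g , GLPermutation.to-inv negated-inverse {g , g′} inv)

  summand-∈mList : ∀ {x} → x ∈ gl → summand x ∈ mList
  summand-∈mList {x} x∈ = InM⇒∈mList (summand x) (summand-InM {x} (gl-sound x∈))

  δ-self : ∀ g → δ g g ≡ 1R
  δ-self g with g ≟E g
  ... | yes _   = refl
  ... | no  g≢g = ⊥-elim (g≢g refl)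

  δ-other : ∀ g m → g ≢ m → δ g m ≡ 0R
  δ-other g m g≢m with g ≟E m
  ... | yes g≡m = ⊥-elim (g≢m g≡m)
  ... | no  _   = refl

  Tstar-at : ∀ m → Tstar m ≡ Sum (map (λ x → δ (summand x) m) gl)
  Tstar-at m = cong Sum (sym (map-∘ gl))

  Tstar-pairing : ∀ (h : MEl → RC) → Sum (map (λ u → Tstar u *R h u) mList) ≡ Sum (map (h ∘ summand) gl)
  Tstar-pairing h = begin
    Sum (map (λ u → Tstar u *R h u) mList)
      ≡⟨ sum-cong _ _ mList (λ u _ → trans (cong (_*R h u) (Tstar-at u)) (*-sumʳ (h u) _ gl)) ⟩
    Sum (map (λ u → Sum (map (λ x → δ (summand x) u *R h u) gl)) mList)
      ≡⟨ sum-swap (λ u x → δ (summand x) u *R h u) mList gl ⟩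
    Sum (map (λ x → Sum (map (λ u → δ (summand x) u *R h u) mList)) gl)
      ≡⟨ sum-cong _ _ gl (λ x x∈ → sift _ (summand x) mList-unique (summand-∈mList x∈)
           (λ u u≢ → trans (cong (_*R h u) (δ-other (summand x) u (u≢ ∘ sym))) (*R-zeroˡ (h u)))) ⟩
    Sum (map (λ x → δ (summand x) (summand x) *R h (summand x)) gl)
      ≡⟨ sum-cong _ _ gl (λ x _ → trans (cong (_*R h (summand x)) (δ-self (summand x))) (*R-identityˡ _)) ⟩
    Sum (map (h ∘ summand) gl)
      ∎
    where open ≡-Reasoning

  σ-Tstar : ∀ (σ : MEl → MatR n) → σAlg σ Tstar ≡ sumM (map (σ ∘ summand) gl)
  σ-Tstar σ = begin
    sumM (map (λ u → Tstar u ·R σ u) mList)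
      ≡⟨ MatSums.sum-cong _ _ mList (λ u _ → trans (cong (_·R σ u) (Tstar-at u)) (sum-· _ (σ u) gl)) ⟩
    sumM (map (λ u → sumM (map (λ x → δ (summand x) u ·R σ u) gl)) mList)
      ≡⟨ MatSums.sum-swap (λ u x → δ (summand x) u ·R σ u) mList gl ⟩
    sumM (map (λ x → sumM (map (λ u → δ (summand x) u ·R σ u) mList)) gl)
      ≡⟨ MatSums.sum-cong _ _ gl (λ x x∈ → MatSums.sift _ (summand x) mList-unique (summand-∈mList x∈)
           (λ u u≢ → trans (cong (_·R σ u) (δ-other (summand x) u (u≢ ∘ sym))) (·-zero (σ u)))) ⟩
    sumM (map (λ x → δ (summand x) (summand x) ·R σ (summand x)) gl)
      ≡⟨ MatSums.sum-cong _ _ gl (λ x _ → trans (cong (_·R σ (summand x)) (δ-self (summand x))) (·-identity _)) ⟩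
    sumM (map (σ ∘ summand) gl)
      ∎
    where open ≡-Reasoning

module Intertwiners (Fq : FiniteField) (R : Field) (k n : ℕ)
                    (σ : Setting.MEl Fq R k n → FieldOps.Mat R n) (rep : Setting.IsRep Fq R k n σ) where

  open Setting Fq R k n
  open TStar Fq R k n
  open GeneralLinear Fq
  open FFMat Fq using () renaming (_⊗_ to _⊗F_; ⊖_ to ⊖F_)
  open FieldOps R using (sumM) renaming (Mat to MatR; _⊗_ to _⊗R_)
  open LinearAlgebra R using (⊗-assoc; sumM-⊗; ⊗-sumM; ⊕-isCommutativeMonoid; module MatSums)
  open LinearAlgebra (FiniteField.fld Fq) using (⊖-⊗; ⊗-⊖; ⊖-involutive)
    renaming (⊗-assoc to ⊗F-assoc)

  σ-mul : ∀ x y → InM x → InM y → σ (x ∙M y) ≡ σ x ⊗R σ y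
  σ-mul = proj₂ rep

  -- A intertwines the twisted action σ ∘ τ with σ; for τ = id this is I₁, for τ = conjW it is I_w
  Intertwines : (MEl → MEl) → MatR n → Set
  Intertwines τ A = ∀ m → InM m → A ⊗R σ (τ m) ≡ σ m ⊗R A

  intertwines-⊗ : ∀ {τ₁ τ₂ A B} → (∀ m → InM m → InM (τ₁ m)) →
                  Intertwines τ₁ A → Intertwines τ₂ B → Intertwines (τ₂ ∘ τ₁) (A ⊗R B)
  intertwines-⊗ {τ₁} {τ₂} {A} {B} τ₁-InM hA hB m m∈ = begin
    (A ⊗R B) ⊗R σ (τ₂ (τ₁ m))    ≡⟨ ⊗-assoc A B (σ (τ₂ (τ₁ m))) ⟩
    A ⊗R (B ⊗R σ (τ₂ (τ₁ m)))    ≡⟨ cong (A ⊗R_) (hB (τ₁ m) (τ₁-InM m m∈)) ⟩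
    A ⊗R (σ (τ₁ m) ⊗R B)         ≡⟨ ⊗-assoc A (σ (τ₁ m)) B ⟨
    (A ⊗R σ (τ₁ m)) ⊗R B         ≡⟨ cong (_⊗R B) (hA m m∈) ⟩
    (σ m ⊗R A) ⊗R B              ≡⟨ ⊗-assoc (σ m) A B ⟩
    σ m ⊗R (A ⊗R B)              ∎
    where open ≡-Reasoning

  conjW-InM : ∀ m → InM m → InM (conjW m)
  conjW-InM (a , b) (a-inv , b-inv) = b-inv , a-inv

  T : MatR n
  T = σAlg σ Tstar

  move-past : ∀ τ f → Intertwines τ f → f ⊗R sumM (map (σ ∘ τ ∘ summand) gl) ≡ T ⊗R f
  move-past τ f hf = begin
    f ⊗R sumM (map (σ ∘ τ ∘ summand) gl)          ≡⟨ ⊗-sumM (σ ∘ τ ∘ summand) f gl ⟩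
    sumM (map (λ x → f ⊗R σ (τ (summand x))) gl)  ≡⟨ MatSums.sum-cong _ _ gl
                                                       (λ x x∈ → hf (summand x) (summand-InM {x} (gl-sound x∈))) ⟩
    sumM (map (λ x → σ (summand x) ⊗R f) gl)      ≡⟨ sumM-⊗ (σ ∘ summand) f gl ⟨
    sumM (map (σ ∘ summand) gl) ⊗R f              ≡⟨ cong (_⊗R f) (σ-Tstar σ) ⟨
    T ⊗R f                                        ∎
    where open ≡-Reasoning

  -- twisting every summand of T by w gives T back: reindex along g ↦ -g⁻¹
  twisted-summands : sumM (map (σ ∘ conjW ∘ summand) gl) ≡ T
  twisted-summands = begin
    sumM (map (σ ∘ conjW ∘ summand) gl)                          ≡⟨ MatSums.sum-cong _ _ gl
                                                                      (λ x _ → cong (λ y → σ (⊖F proj₂ x , y)) (sym (⊖-involutive (proj₁ x)))) ⟩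
    sumM (map (σ ∘ summand ∘ GLPermutation.to negated-inverse) gl) ≡⟨ sum-gl-invariant ⊕-isCommutativeMonoid negated-inverse (σ ∘ summand) ⟩
    sumM (map (σ ∘ summand) gl)                                  ≡⟨ σ-Tstar σ ⟨
    T                                                            ∎
    where open ≡-Reasoning

  -- the key identity: T σ(w m w⁻¹) = σ(m) T, i.e. T ∈ I_w; reindex along g ↦ a⁻¹ g b
  T-twisted : Intertwines conjW T
  T-twisted (a , b) m-inv@((a′ , aa′ , a′a) , (b′ , bb′ , b′b)) = begin
    T ⊗R σ (b , a)
      ≡⟨ cong (_⊗R σ (b , a)) (σ-Tstar σ) ⟩
    sumM (map (σ ∘ summand) gl) ⊗R σ (b , a)
      ≡⟨ sumM-⊗ (σ ∘ summand) (σ (b , a)) gl ⟩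
    sumM (map (λ x → σ (summand x) ⊗R σ (b , a)) gl)
      ≡⟨ MatSums.sum-cong _ _ gl (λ x x∈ → sym (σ-mul (summand x) (b , a) (summand-InM {x} (gl-sound x∈))
                                                     (conjW-InM (a , b) m-inv))) ⟩
    sumM (map (λ x → σ (summand x ∙M (b , a))) gl)
      ≡⟨ MatSums.sum-cong _ _ gl (λ x _ → cong σ (sym (translate-summand x))) ⟩
    sumM (map (λ x → σ ((a , b) ∙M summand (GLPermutation.to π x))) gl)
      ≡⟨ sum-gl-invariant ⊕-isCommutativeMonoid π (λ x → σ ((a , b) ∙M summand x)) ⟩
    sumM (map (λ x → σ ((a , b) ∙M summand x)) gl)
      ≡⟨ MatSums.sum-cong _ _ gl (λ x x∈ → σ-mul (a , b) (summand x) m-inv (summand-InM {x} (gl-sound x∈))) ⟩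
    sumM (map (λ x → σ (a , b) ⊗R σ (summand x)) gl)
      ≡⟨ ⊗-sumM (σ ∘ summand) (σ (a , b)) gl ⟨
    σ (a , b) ⊗R sumM (map (σ ∘ summand) gl)
      ≡⟨ cong (σ (a , b) ⊗R_) (σ-Tstar σ) ⟨
    σ (a , b) ⊗R T
      ∎
    where
    open ≡-Reasoning
    π : GLPermutation k
    π = translation (a′ , a) (b , b′) (a′a , aa′) (bb′ , b′b)
    translate-summand : ∀ x → (a , b) ∙M summand (GLPermutation.to π x) ≡ summand x ∙M (b , a)
    translate-summand (x , x′) = cong₂ _,_
      (trans (cong (a ⊗F_) (⊗F-assoc a′ x b)) (cancel-left a a′ (x ⊗F b) aa′))
      (begin
        b ⊗F (⊖F (b′ ⊗F (x′ ⊗F a)))   ≡⟨ ⊗-⊖ b (b′ ⊗F (x′ ⊗F a)) ⟩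
        ⊖F (b ⊗F (b′ ⊗F (x′ ⊗F a)))   ≡⟨ cong ⊖F_ (cancel-left b b′ (x′ ⊗F a) bb′) ⟩
        ⊖F (x′ ⊗F a)                  ≡⟨ ⊖-⊗ x′ a ⟨
        (⊖F x′) ⊗F a                  ∎)

  I₁→I_w : ∀ f → InI1 σ f → (T ⊗R f ≡ f ⊗R T) × InIw σ (T ⊗R f)
  I₁→I_w f hf =
    sym (trans (cong (f ⊗R_) (σ-Tstar σ)) (move-past (λ m → m) f hf)) ,
    intertwines-⊗ {A = T} {B = f} conjW-InM T-twisted hf

  I_w→I₁ : ∀ f → InIw σ f → (T ⊗R f ≡ f ⊗R T) × InI1 σ (T ⊗R f)
  I_w→I₁ f hf =
    sym (trans (cong (f ⊗R_) (sym twisted-summands)) (move-past conjW f hf)) ,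
    intertwines-⊗ {A = T} {B = f} conjW-InM T-twisted hf

-- The first nonzero entry of a row (1 for the zero row). Scaling a nonzero row
-- by s scales its leading entry by s, so the leading entry of the first row
-- picks one representative in each orbit of F_q^× acting on GL_k(F_q).
module LeadingEntry (Fq : FiniteField) where

  open FiniteField Fq using (_≟_; fld)
  open Field fld using (Carrier; 0#; 1#; _*_; 0≢1; inverse; isCommutativeRing)
  open IsCommutativeRing isCommutativeRing using (*-assoc; *-comm; *-identityˡ; *-identityʳ; zeroʳ)

  leading : ∀ {m} → (Fin m → Carrier) → Carrier
  leading {zero}  f = 1#
  leading {suc m} f with f Fin.zero ≟ 0#
  ... | yes _ = leading (f ∘ Fin.suc)
  ... | no  _ = f Fin.zero

  leading-nonzero : ∀ {m} (f : Fin m → Carrier) → leading f ≢ 0#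
  leading-nonzero {zero}  f 1≡0 = 0≢1 (sym 1≡0)
  leading-nonzero {suc m} f with f Fin.zero ≟ 0#
  ... | yes _    = leading-nonzero (f ∘ Fin.suc)
  ... | no  f0≢0 = f0≢0

  leading-cong : ∀ {m} {f g : Fin m → Carrier} → (∀ j → f j ≡ g j) → leading f ≡ leading g
  leading-cong {zero}          f≗g = refl
  leading-cong {suc m} {f} {g} f≗g with f Fin.zero ≟ 0# | g Fin.zero ≟ 0#
  ... | yes _    | yes _    = leading-cong (f≗g ∘ Fin.suc)
  ... | no  _    | no  _    = f≗g Fin.zero
  ... | yes f0≡0 | no  g0≢0 = ⊥-elim (g0≢0 (trans (sym (f≗g Fin.zero)) f0≡0))
  ... | no  f0≢0 | yes g0≡0 = ⊥-elim (f0≢0 (trans (f≗g Fin.zero) g0≡0))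

  unscale : ∀ {s} (s≢0 : s ≢ 0#) t → proj₁ (inverse s s≢0) * (s * t) ≡ t
  unscale {s} s≢0 t with inverse s s≢0
  ... | s⁻¹ , ss⁻¹≡1 = trans (sym (*-assoc s⁻¹ s t)) (trans (cong (_* t) (trans (*-comm s⁻¹ s) ss⁻¹≡1)) (*-identityˡ t))

  nonzero-* : ∀ {s t} → s ≢ 0# → t ≢ 0# → s * t ≢ 0#
  nonzero-* {s} {t} s≢0 t≢0 st≡0 =
    t≢0 (trans (sym (unscale s≢0 t)) (trans (cong (_ *_) st≡0) (zeroʳ _)))

  scale-fixes⇒1 : ∀ {s t} → s ≢ 0# → s * t ≡ s → t ≡ 1#
  scale-fixes⇒1 {s} {t} s≢0 st≡s =
    trans (sym (unscale s≢0 t)) (trans (cong (_ *_) (trans st≡s (sym (*-identityʳ s)))) (unscale s≢0 1#))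

  leading-scale : ∀ {m} s (f : Fin m → Carrier) → s ≢ 0# → ¬ (∀ j → f j ≡ 0#) →
                  leading (λ j → s * f j) ≡ s * leading f
  leading-scale {zero}  s f s≢0 f≢0 = ⊥-elim (f≢0 (λ ()))
  leading-scale {suc m} s f s≢0 f≢0 with f Fin.zero ≟ 0# | (s * f Fin.zero) ≟ 0#
  ... | yes f0≡0 | yes _     = leading-scale s (f ∘ Fin.suc) s≢0
                                 (λ rest≡0 → f≢0 λ { Fin.zero → f0≡0 ; (Fin.suc j) → rest≡0 j })
  ... | yes f0≡0 | no  sf0≢0 = ⊥-elim (sf0≢0 (trans (cong (s *_) f0≡0) (zeroʳ s)))
  ... | no  f0≢0 | yes sf0≡0 = ⊥-elim (nonzero-* s≢0 f0≢0 sf0≡0)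
  ... | no  _    | no  _     = refl

module SquareOfTStar (Fq : FiniteField) (R : Field) (k′ : ℕ) where

  k : ℕ
  k = suc k′

  open Setting Fq R k 0
  open TStar Fq R k 0
  open GeneralLinear Fq
  open LeadingEntry Fq
  open FiniteField Fq using (_≟_; elems; complete; unique; fld) renaming (Carrier to Cq; 0# to 0q; 1# to 1q)
  open Field fld using () renaming (_*_ to _*q_; 0≢1 to 0q≢1q; inverse to inverseq; isCommutativeRing to Fq-ring)
  open IsCommutativeRing Fq-ring using () renaming (*-comm to *q-comm; zeroˡ to *q-zeroˡ)
  open FFMat Fq using (glList; entry) renaming (Mat to MatF; _⊗_ to _⊗F_; 𝟙 to 𝟙F; _·_ to _·F_)
  module FqM = LinearAlgebra fld
  open Field R using () renaming (Carrier to RC; 0# to 0R; 1# to 1R; _*_ to _*R_; isCommutativeRing to R-ring)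
  open IsCommutativeRing R-ring using (+-isCommutativeMonoid)
    renaming (*-assoc to *R-assoc; *-comm to *R-comm; *-identityˡ to *R-identityˡ; zeroˡ to *R-zeroˡ)
  open FieldOps R using (fromℕ)
  open LinearAlgebra R using (Sum; sum-cong; sum-swap; sift; *-sumˡ; *-sumʳ; sum-const)

  lead : MatF k → Cq
  lead A = leading (entry A Fin.zero)

  first-row-nonzero : ∀ (A B : MatF k) → A ⊗F B ≡ 𝟙F → ¬ (∀ j → entry A Fin.zero j ≡ 0q)
  first-row-nonzero A B AB≡𝟙 row≡0 = 0q≢1q (begin
    0q                                                  ≡⟨ FqM.sum-ε _ (FqM.indices k)
                                                             (λ l _ → trans (cong (_*q _) (row≡0 l)) (*q-zeroˡ _)) ⟨
    FqM.∑ k (λ l → entry A Fin.zero l *q entry B l Fin.zero) ≡⟨ FqM.entry-⊗ A B Fin.zero Fin.zero ⟨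
    entry (A ⊗F B) Fin.zero Fin.zero                    ≡⟨ cong (λ M → entry M Fin.zero Fin.zero) AB≡𝟙 ⟩
    entry (𝟙F {k}) Fin.zero Fin.zero                    ≡⟨ FqM.𝟙-diag {k} Fin.zero ⟩
    1q                                                  ∎)
    where open ≡-Reasoning

  lead-scale : ∀ s (A B : MatF k) → s ≢ 0q → A ⊗F B ≡ 𝟙F → lead (s ·F A) ≡ s *q lead A
  lead-scale s A B s≢0 AB≡𝟙 =
    trans (leading-cong {g = λ j → s *q entry A Fin.zero j} (λ j → FqM.entry-mk {f = λ i j → s *q entry A i j} Fin.zero j))
          (leading-scale s (entry A Fin.zero) s≢0 (first-row-nonzero A B AB≡𝟙))

  ⟦_≡_⟧ : Cq → Cq → RC
  ⟦ l ≡ t ⟧ with l ≟ t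
  ... | yes _ = 1R
  ... | no  _ = 0R

  ⟦≡⟧-self : ∀ l → ⟦ l ≡ l ⟧ ≡ 1R
  ⟦≡⟧-self l with l ≟ l
  ... | yes _   = refl
  ... | no  l≢l = ⊥-elim (l≢l refl)

  ⟦≡⟧-other : ∀ l t → l ≢ t → ⟦ l ≡ t ⟧ ≡ 0R
  ⟦≡⟧-other l t l≢t with l ≟ t
  ... | yes l≡t = ⊥-elim (l≢t l≡t)
  ... | no  _   = refl

  ⟦≡⟧-scale : ∀ s l → s ≢ 0q → ⟦ s *q l ≡ s ⟧ ≡ ⟦ l ≡ 1q ⟧
  ⟦≡⟧-scale s l s≢0 with (s *q l) ≟ s | l ≟ 1q
  ... | yes _    | yes _    = refl
  ... | no  _    | no  _    = refl
  ... | yes sl≡s | no  l≢1  = ⊥-elim (l≢1 (scale-fixes⇒1 s≢0 sl≡s))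
  ... | no  sl≢s | yes refl = ⊥-elim (sl≢s (IsCommutativeRing.*-identityʳ Fq-ring s))

  nonzero? : (a : Cq) → Dec (a ≢ 0q)
  nonzero? a = ¬? (a ≟ 0q)

  nonzeros : List Cq
  nonzeros = filter nonzero? elems

  length-without-0 : ∀ xs → Unique xs → 0q ∈ xs → suc (length (filter nonzero? xs)) ≡ length xs
  length-without-0 (x ∷ xs) (x∉ ∷ _) (here refl) =
    cong suc (trans (cong length (filter-reject nonzero? (λ 0≢0 → 0≢0 refl)))
                    (cong length (filter-all nonzero? (All.tabulate (λ y∈ y≡0 → All.lookup x∉ y∈ (sym y≡0))))))
  length-without-0 (x ∷ xs) (x∉ ∷ u) (there 0∈) =
    trans (cong (suc ∘ length) (filter-accept nonzero? (All.lookup x∉ 0∈)))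
          (cong suc (length-without-0 xs u 0∈))

  length-nonzeros : FiniteField.card Fq ∸ 1 ≡ length nonzeros
  length-nonzeros = cong (_∸ 1) (sym (length-without-0 elems unique (complete 0q)))

  one-leading-entry : ∀ (A : MatF k) → Sum (map (λ s → ⟦ lead A ≡ s ⟧) nonzeros) ≡ 1R
  one-leading-entry A =
    trans (sift _ (lead A) (filter⁺ nonzero? unique)
                (∈-filter⁺ nonzero? (complete (lead A)) (leading-nonzero (entry A Fin.zero)))
                (λ s s≢lead → ⟦≡⟧-other (lead A) s (s≢lead ∘ sym)))
          (⟦≡⟧-self (lead A))

  orbit-sum : ∀ (Ψ : MatF k × MatF k → RC) →
              (∀ s t (st≡1 : s *q t ≡ 1q) x → Ψ (GLPermutation.to (scaling s t st≡1) x) ≡ Ψ x) →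
              Sum (map Ψ gl) ≡ fromℕ (length nonzeros) *R Sum (map (λ x → ⟦ lead (proj₁ x) ≡ 1q ⟧ *R Ψ x) gl)
  orbit-sum Ψ Ψ-invariant = begin
    Sum (map Ψ gl)
      ≡⟨ sum-cong _ _ gl (λ x _ → sym (trans (cong (_*R Ψ x) (one-leading-entry (proj₁ x))) (*R-identityˡ (Ψ x)))) ⟩
    Sum (map (λ x → Sum (map (λ s → ⟦ lead (proj₁ x) ≡ s ⟧) nonzeros) *R Ψ x) gl)
      ≡⟨ sum-cong _ _ gl (λ x _ → *-sumʳ (Ψ x) _ nonzeros) ⟩
    Sum (map (λ x → Sum (map (λ s → ⟦ lead (proj₁ x) ≡ s ⟧ *R Ψ x) nonzeros)) gl)
      ≡⟨ sum-swap (λ x s → ⟦ lead (proj₁ x) ≡ s ⟧ *R Ψ x) gl nonzeros ⟩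
    Sum (map (λ s → Sum (map (λ x → ⟦ lead (proj₁ x) ≡ s ⟧ *R Ψ x) gl)) nonzeros)
      ≡⟨ sum-cong _ _ nonzeros (λ s s∈ → fibre-sum s (proj₂ (∈-filter⁻ nonzero? {xs = elems} s∈))) ⟩
    Sum (map (λ _ → S) nonzeros)
      ≡⟨ sum-const S nonzeros ⟩
    fromℕ (length nonzeros) *R S
      ∎
    where
    open ≡-Reasoning
    S : RC
    S = Sum (map (λ x → ⟦ lead (proj₁ x) ≡ 1q ⟧ *R Ψ x) gl)
    -- scaling by s ∈ F_q^× maps the matrices with leading entry 1 onto those with leading entry s
    fibre-sum : ∀ s → s ≢ 0q → Sum (map (λ x → ⟦ lead (proj₁ x) ≡ s ⟧ *R Ψ x) gl) ≡ S
    fibre-sum s s≢0 with inverseq s s≢0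
    ... | t , st≡1 = trans
      (sym (sum-gl-invariant +-isCommutativeMonoid (scaling s t st≡1) (λ x → ⟦ lead (proj₁ x) ≡ s ⟧ *R Ψ x)))
      (sum-cong _ _ gl (λ { (x , x′) x∈ → cong₂ _*R_
         (trans (cong ⟦_≡ s ⟧ (lead-scale s x x′ s≢0 (proj₁ (gl-sound x∈)))) (⟦≡⟧-scale s (lead x) s≢0))
         (Ψ-invariant s t st≡1 (x , x′)) }))

  -- the coefficient of m in (T*)², as a function of the index of the first factor
  Φ : MEl → MatF k × MatF k → RC
  Φ m (x , x′) = Sum (map (λ y → δ (x ⊗F proj₁ y , x′ ⊗F proj₂ y) m) gl)

  square-as-double-sum : ∀ m → (Tstar ⋆ Tstar) m ≡ Sum (map (Φ m) gl)
  square-as-double-sum m = begin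
    Sum (map (λ u → Sum (map (λ v → δ (u ∙M v) m *R (Tstar u *R Tstar v)) mList)) mList)
      ≡⟨ sum-cong _ _ mList (λ u _ → trans (sum-cong _ _ mList (λ v _ → rearrange (δ (u ∙M v) m) (Tstar u) (Tstar v)))
                                           (sym (*-sumˡ (Tstar u) _ mList))) ⟩
    Sum (map (λ u → Tstar u *R Sum (map (λ v → Tstar v *R δ (u ∙M v) m) mList)) mList)
      ≡⟨ Tstar-pairing (λ u → Sum (map (λ v → Tstar v *R δ (u ∙M v) m) mList)) ⟩
    Sum (map (λ x → Sum (map (λ v → Tstar v *R δ (summand x ∙M v) m) mList)) gl)
      ≡⟨ sum-cong _ _ gl (λ x _ → Tstar-pairing (λ v → δ (summand x ∙M v) m)) ⟩
    Sum (map (λ x → Sum (map (λ y → δ (summand x ∙M summand y) m) gl)) gl)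
      ≡⟨ sum-cong _ _ gl (λ x _ → sum-cong _ _ gl (λ y _ →
           cong (λ b → δ (proj₁ x ⊗F proj₁ y , b) m) (FqM.⊖⊗⊖ (proj₂ x) (proj₂ y)))) ⟩
    Sum (map (Φ m) gl)
      ∎
    where
    open ≡-Reasoning
    rearrange : ∀ d a b → d *R (a *R b) ≡ a *R (b *R d)
    rearrange d a b = trans (*R-comm d (a *R b)) (*R-assoc a b d)

  -- scaling the first factor by s and the second by s⁻¹ does not change the product
  Φ-invariant : ∀ m s t (st≡1 : s *q t ≡ 1q) x → Φ m (GLPermutation.to (scaling s t st≡1) x) ≡ Φ m x
  Φ-invariant m s t st≡1 (x , x′) = trans
    (sym (sum-gl-invariant +-isCommutativeMonoid (scaling t s ts≡1) (λ y → δ ((s ·F x) ⊗F proj₁ y , (t ·F x′) ⊗F proj₂ y) m)))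
    (sum-cong _ _ gl (λ y _ → cong (λ g → δ g m)
      (cong₂ _,_ (scalars-cancel x (proj₁ y) st≡1) (scalars-cancel x′ (proj₂ y) ts≡1))))
    where
    ts≡1 : t *q s ≡ 1q
    ts≡1 = trans (*q-comm t s) st≡1

  Tstar-square-vanishes : fromℕ (length nonzeros) ≡ 0R → ∀ m → (Tstar ⋆ Tstar) m ≡ 0R
  Tstar-square-vanishes q-1≡0 m = begin
    (Tstar ⋆ Tstar) m              ≡⟨ square-as-double-sum m ⟩
    Sum (map (Φ m) gl)             ≡⟨ orbit-sum (Φ m) (Φ-invariant m) ⟩
    fromℕ (length nonzeros) *R S   ≡⟨ cong (_*R S) q-1≡0 ⟩
    0R *R S                        ≡⟨ *R-zeroˡ S ⟩
    0R                             ∎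
    where
    open ≡-Reasoning
    S : RC
    S = Sum (map (λ x → ⟦ lead (proj₁ x) ≡ 1q ⟧ *R Φ m x) gl)

proposition3p4 : (Fq : FiniteField) (p : ℕ) → Prime p →
    FieldOps.HasChar (FiniteField.fld Fq) p →
    (∃ λ r → FiniteField.card Fq ≡ p ^ r) →
    (R : Field) → FieldOps.IsAlgClosed R →
    (ℓ : ℕ) → FieldOps.HasChar R ℓ → ℓ ≢ p →
    (k : ℕ) → k ≥ 1 →
    let q = FiniteField.card Fq in
    (ℓ ∣ q ∸ 1 →
      Setting._≈RM_ Fq R k 0 (Setting._⋆_ Fq R k 0 (Setting.Tstar Fq R k 0) (Setting.Tstar Fq R k 0))
        (Setting.zeroRM Fq R k 0)) ×
    ((n : ℕ) (σ : Setting.MEl Fq R k n → FieldOps.Mat R n) → Setting.IsRep Fq R k n σ →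
      let open Setting Fq R k n in
      let open FieldOps R using (_⊗_) in
      let T = σAlg σ Tstar in
      (∀ f → InI1 σ f → (T ⊗ f ≡ f ⊗ T) × InIw σ (T ⊗ f)) ×
      (∀ f → InIw σ f → (T ⊗ f ≡ f ⊗ T) × InI1 σ (T ⊗ f)))
proposition3p4 Fq _ _ _ _ R _ ℓ charR _ (suc k′) (s≤s z≤n) =
  (λ ℓ∣q-1 m _ → Tstar-square-vanishes (q-1-vanishes ℓ∣q-1) m) ,
  (λ n σ rep → let open Intertwiners Fq R (suc k′) n σ rep in I₁→I_w , I_w→I₁)
  where
  open SquareOfTStar Fq R k′ using (Tstar-square-vanishes; nonzeros; length-nonzeros)
  q-1-vanishes : ℓ ∣ FiniteField.card Fq ∸ 1 → FieldOps.fromℕ R (length nonzeros) ≡ Field.0# R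
  q-1-vanishes ℓ∣q-1 = LinearAlgebra.char-multiple R charR (subst (ℓ ∣_) length-nonzeros ℓ∣q-1)
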